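{- Let $n$ be a positive integer and let $N_1=\{2,3,4,\dots\}$ denote the set of natural numbers greater than $1$. For $i\in N_1$ define \[ X_i=\{x\in N_1 : x\leqslant n,\ x=i\cdot j \text{ for some } j\in N_1 \text{ with } j\geqslant i\}. \] Then for all $s,i_1,i_2,\dots,i_s\in N_1$ with $1<i_1<i_2<\dots<i_s\leqslant\lfloor\sqrt{n}\rfloor$, \[ \lvert X_{i_1}\cap X_{i_2}\cap\dots\cap X_{i_s}\rvert=\left\lfloor\frac{n}{\operatorname{LCM}(i_1,\dots,i_s)}\right\rfloor-\left\lfloor\frac{i_s^2-1}{\operatorname{LCM}(i_1,\dots,i_s)}\right\rfloor. \]
   Context: $\lfloor x\rfloor$ denotes the floor of $x$, and $\operatorname{LCM}(i_1,\dots,i_s)$ denotes the least common multiple of the positive integers $i_1,\dots,i_s$. $\lvert\cdot\rvert$ denotes the cardinality of a finite set. -}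

module Defs where

open import Data.Nat using (ℕ; zero; suc; _+_; _*_; _≤_; _<_; _/_)
open import Data.Nat.Properties using (_≟_; _≤?_)
open import Data.Nat.LCM using (lcm)
open import Data.Fin using (Fin)
open import Data.List using (List; upTo; filter; length)
open import Data.List.Relation.Unary.Unique.Propositional using (Unique)
open import Data.List.Membership.Propositional using (_∈_)
open import Data.Product using (Σ; _×_; _,_)
open import Relation.Binary.PropositionalEquality using (_≡_)
open import Data.Vec.Functional using (foldr)

N₁ : ℕ → Set
N₁ x = 2 ≤ x

InX : ℕ → ℕ → ℕ → Set
InX n i x = N₁ x × x ≤ n × Σ ℕ (λ j → N₁ j × i ≤ j × x ≡ i * j)

InAll : ℕ → (s : ℕ) → (Fin s → ℕ) → ℕ → Set
InAll n s i x = (k : Fin s) → InX n (i k) x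

-- LCM(i_0,…,i_{s-1}) (lcm of the empty family is 1, unused since s ≥ 2)
lcmAll : (s : ℕ) → (Fin s → ℕ) → ℕ
lcmAll s i = foldr lcm 1 i

-- |A| = c for a set A ⊆ ℕ given as a predicate: A is enumerated without
-- repetition by a list of length c
HasCard : (ℕ → Set) → ℕ → Set
HasCard A c = Σ (List ℕ) (λ L → Unique L × ((x : ℕ) → (x ∈ L → A x) × (A x → x ∈ L)) × length L ≡ c)

-- floor division ⌊m / d⌋ (d = 0 does not occur in the theorem; set to 0 there)
_div_ : ℕ → ℕ → ℕ
m div zero = 0
m div (suc d) = m / suc d

{-# OPTIONS --safe #-}
module Submission where

-- X_i is the set of multiples of i in [i², n]. As i_s is the largest index, a common
-- multiple x of the i_k with x ≥ i_s² also satisfies x ≥ i_k², so the intersection is the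
-- set of multiples of L = LCM(i_1,…,i_s) in [i_s², n]; the multiples qL of L in [p+1, n]
-- are those with ⌊p/L⌋ < q ≤ ⌊n/L⌋.

open import Defs
open import Data.Nat using (ℕ; zero; suc; _+_; _*_; _∸_; _/_; _≤_; _<_; NonZero; z≤n; s≤s; >-nonZero)
open import Data.Fin using (Fin; fromℕ)
open import Data.Fin.Base using () renaming (_<_ to _<ᶠ_)
open import Data.Nat.Properties
open import Data.Nat.DivMod using (m*n/n≡m; m/n*n≤m; /-monoˡ-≤; m<n*o⇒m/o<n)
open import Data.Nat.Divisibility using (_∣_; divides; ∣-trans; 1∣_)
open import Data.Nat.GCD using (gcd)
open import Data.Nat.LCM using (lcm; m∣lcm[m,n]; n∣lcm[m,n]; lcm-least; gcd*lcm)
import Data.Fin as Fin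
import Data.Fin.Properties as Fin
open import Data.List using (List; map; applyUpTo; length)
open import Data.List.Properties using (length-map; length-applyUpTo)
open import Data.List.Membership.Propositional using (_∈_)
open import Data.List.Membership.Propositional.Properties using (∈-map⁺; ∈-map⁻; ∈-applyUpTo⁺; ∈-applyUpTo⁻)
open import Data.List.Relation.Unary.Unique.Propositional using (Unique)
import Data.List.Relation.Unary.Unique.Propositional.Properties as Unique
open import Data.Product using (_×_; _,_; proj₁; proj₂)
open import Function using (_∘_)
open import Function.Bundles using (_⇔_; mk⇔; Equivalence)
import Function.Properties.Equivalence as ⇔
open import Relation.Nullary using (yes; no)
open import Relation.Binary.PropositionalEquality using (_≡_; _≢_; refl; sym; trans; cong; subst)

lcm-pos : ∀ {m n} → 0 < m → 0 < n → 0 < lcm m n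
lcm-pos {m} {n} 0<m 0<n = n≢0⇒n>0 lcm≢0
  where
  lcm≢0 : lcm m n ≢ 0
  lcm≢0 lcm≡0 = n>0⇒n≢0 (*-mono-≤ 0<m 0<n)
    (trans (sym (gcd*lcm m n)) (trans (cong (gcd m n *_) lcm≡0) (*-zeroʳ (gcd m n))))

lcmAll-pos : ∀ s (i : Fin s → ℕ) → (∀ k → 0 < i k) → 0 < lcmAll s i
lcmAll-pos zero    i i>0 = s≤s z≤n
lcmAll-pos (suc s) i i>0 = lcm-pos (i>0 Fin.zero) (lcmAll-pos s (i ∘ Fin.suc) (i>0 ∘ Fin.suc))

∣lcmAll : ∀ s (i : Fin s → ℕ) k → i k ∣ lcmAll s i
∣lcmAll (suc s) i Fin.zero    = m∣lcm[m,n] (i Fin.zero) _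
∣lcmAll (suc s) i (Fin.suc k) = ∣-trans (∣lcmAll s (i ∘ Fin.suc) k) (n∣lcm[m,n] (i Fin.zero) _)

lcmAll-least : ∀ s (i : Fin s → ℕ) {x} → (∀ k → i k ∣ x) → lcmAll s i ∣ x
lcmAll-least zero    i {x} i∣x = 1∣ x
lcmAll-least (suc s) i     i∣x = lcm-least (i∣x Fin.zero) (lcmAll-least s (i ∘ Fin.suc) (i∣x ∘ Fin.suc))

HasCard-resp : ∀ {A B : ℕ → Set} {c} → (∀ x → A x ⇔ B x) → HasCard A c → HasCard B c
HasCard-resp A⇔B (L , unique , L≐A , length≡c) =
  L , unique , (λ x → Equivalence.to (A⇔B x) ∘ proj₁ (L≐A x) , proj₂ (L≐A x) ∘ Equivalence.from (A⇔B x)) , length≡c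

module _ (d : ℕ) .{{_ : NonZero d}} where

  m*d≤n⇒m≤n/d : ∀ {m n} → m * d ≤ n → m ≤ n / d
  m*d≤n⇒m≤n/d {m} m*d≤n = ≤-trans (≤-reflexive (sym (m*n/n≡m m d))) (/-monoˡ-≤ d m*d≤n)

  m≤n/d⇒m*d≤n : ∀ {m n} → m ≤ n / d → m * d ≤ n
  m≤n/d⇒m*d≤n {n = n} m≤n/d = ≤-trans (*-monoˡ-≤ d m≤n/d) (m/n*n≤m n d)

  n/d<m⇒n<m*d : ∀ {m n} → n / d < m → n < m * d
  n/d<m⇒n<m*d n/d<m = ≰⇒> (<⇒≱ n/d<m ∘ m*d≤n⇒m≤n/d)

interval : ℕ → ℕ → List ℕ
interval a b = applyUpTo (λ k → suc (k + a)) (b ∸ a)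

∈-interval⁻ : ∀ {a b x} → x ∈ interval a b → a < x × x ≤ b
∈-interval⁻ {a} {b} x∈ with k , k<b∸a , refl ← ∈-applyUpTo⁻ (λ k → suc (k + a)) x∈ =
  s≤s (m≤n+m a k) , m≤o∸n⇒m+n≤o (suc k) a≤b k<b∸a
  where
  a≤b : a ≤ b
  a≤b = <⇒≤ (m∸n≢0⇒n<m (m<n⇒n≢0 k<b∸a))

∈-interval⁺ : ∀ {a b x} → a < x → x ≤ b → x ∈ interval a b
∈-interval⁺ {a} {b} {x} a<x x≤b = subst (_∈ interval a b) x≡ (∈-applyUpTo⁺ (λ k → suc (k + a)) k<b∸a)
  where
  k = x ∸ suc a
  k+suc-a≡x : k + suc a ≡ x
  k+suc-a≡x = m∸n+n≡m a<x
  x≡ : suc (k + a) ≡ x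
  x≡ = trans (sym (+-suc k a)) k+suc-a≡x
  k<b∸a : k < b ∸ a
  k<b∸a = m+n≤o⇒m≤o∸n (suc k) (subst (_≤ b) (sym x≡) x≤b)

interval-unique : ∀ a b → Unique (interval a b)
interval-unique a b = Unique.applyUpTo⁺₁ _ (b ∸ a) (λ i<j _ → <⇒≢ (s≤s (+-monoˡ-< a i<j)))

length-interval : ∀ a b → length (interval a b) ≡ b ∸ a
length-interval a b = length-applyUpTo _ (b ∸ a)

MultipleIn : ℕ → ℕ → ℕ → ℕ → Set
MultipleIn d lo hi x = d ∣ x × lo ≤ x × x ≤ hi

multiples-card : ∀ d p n .{{_ : NonZero d}} → HasCard (MultipleIn d (suc p) n) (n / d ∸ p / d)
multiples-card d p n =
  map (_* d) qs , Unique.map⁺ (*-cancelʳ-≡ _ _ d) (interval-unique a b) , membership ,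
  trans (length-map (_* d) qs) (length-interval a b)
  where
  a = p / d
  b = n / d
  qs = interval a b
  membership : ∀ x → (x ∈ map (_* d) qs → MultipleIn d (suc p) n x) × (MultipleIn d (suc p) n x → x ∈ map (_* d) qs)
  membership x = listed⇒multiple , multiple⇒listed
    where
    listed⇒multiple : x ∈ map (_* d) qs → MultipleIn d (suc p) n x
    listed⇒multiple x∈ with q , q∈qs , refl ← ∈-map⁻ (_* d) x∈ with a<q , q≤b ← ∈-interval⁻ q∈qs =
      divides q refl , n/d<m⇒n<m*d d a<q , m≤n/d⇒m*d≤n d q≤b
    multiple⇒listed : MultipleIn d (suc p) n x → x ∈ map (_* d) qs
    multiple⇒listed (divides q refl , p<x , x≤n) =
      ∈-map⁺ (_* d) {x = q} (∈-interval⁺ (m<n*o⇒m/o<n p<x) (m*d≤n⇒m≤n/d d x≤n))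

multiples-card-div : ∀ d lo n → 0 < d → 0 < lo → HasCard (MultipleIn d lo n) (n div d ∸ (lo ∸ 1) div d)
multiples-card-div (suc _) (suc p) n _ _ = multiples-card _ p n

InX⇔MultipleIn : ∀ {n i x} → 2 ≤ i → InX n i x ⇔ MultipleIn i (i * i) n x
InX⇔MultipleIn {n} {i} {x} 2≤i = mk⇔ inX⇒multiple multiple⇒inX
  where
  instance _ = >-nonZero (≤-trans (n≤1+n 1) 2≤i)
  inX⇒multiple : InX n i x → MultipleIn i (i * i) n x
  inX⇒multiple (_ , x≤n , j , _ , i≤j , refl) = divides j (*-comm i j) , *-monoʳ-≤ i i≤j , x≤n
  multiple⇒inX : MultipleIn i (i * i) n x → InX n i x
  multiple⇒inX (divides j refl , i*i≤j*i , x≤n) =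
    ≤-trans 2≤i (≤-trans (m≤m*n i i) i*i≤j*i) , x≤n , j , ≤-trans 2≤i i≤j , i≤j , *-comm j i
    where
    i≤j : i ≤ j
    i≤j = *-cancelʳ-≤ i j i i*i≤j*i

InAll⇔MultipleIn : ∀ {n s} {i : Fin s → ℕ} {x} → (∀ k → 2 ≤ i k) → (top : Fin s) → (∀ k → i k ≤ i top) →
                   InAll n s i x ⇔ MultipleIn (lcmAll s i) (i top * i top) n x
InAll⇔MultipleIn {n} {s} {i} {x} i≥2 top i≤top = mk⇔ inAll⇒multiple multiple⇒inAll
  where
  inX⇔ : ∀ k → InX n (i k) x ⇔ MultipleIn (i k) (i k * i k) n x
  inX⇔ k = InX⇔MultipleIn (i≥2 k)
  inAll⇒multiple : InAll n s i x → MultipleIn (lcmAll s i) (i top * i top) n x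
  inAll⇒multiple x∈ = lcmAll-least s i (proj₁ ∘ multipleₖ) , proj₂ (multipleₖ top)
    where
    multipleₖ : ∀ k → MultipleIn (i k) (i k * i k) n x
    multipleₖ k = Equivalence.to (inX⇔ k) (x∈ k)
  multiple⇒inAll : MultipleIn (lcmAll s i) (i top * i top) n x → InAll n s i x
  multiple⇒inAll (L∣x , top²≤x , x≤n) k = Equivalence.from (inX⇔ k)
    (∣-trans (∣lcmAll s i k) L∣x , ≤-trans (*-mono-≤ (i≤top k) (i≤top k)) top²≤x , x≤n)

≤-last : ∀ {t} (i : Fin (suc t) → ℕ) → (∀ a b → a <ᶠ b → i a ≤ i b) → ∀ k → i k ≤ i (fromℕ t)
≤-last {t} i mono k with k Fin.≟ fromℕ t
... | yes refl = ≤-refl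
... | no k≢last = mono k (fromℕ t) (Fin.≤∧≢⇒< (Fin.≤fromℕ k) k≢last)

mainTheorem2 : (n : ℕ) → 1 ≤ n → (t : ℕ) → 2 ≤ suc t → (i : Fin (suc t) → ℕ)
    → ((k : Fin (suc t)) → 2 ≤ i k)
    → ((a b : Fin (suc t)) → a <ᶠ b → i a < i b)
    → i (fromℕ t) * i (fromℕ t) ≤ n
    → HasCard (InAll n (suc t) i)
        (n div lcmAll (suc t) i ∸ (i (fromℕ t) * i (fromℕ t) ∸ 1) div lcmAll (suc t) i)
mainTheorem2 n _ t _ i i≥2 increasing _ =
  HasCard-resp (λ _ → ⇔.sym (InAll⇔MultipleIn i≥2 (fromℕ t) i≤last))
    (multiples-card-div (lcmAll (suc t) i) (i (fromℕ t) * i (fromℕ t)) n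
      (lcmAll-pos (suc t) i i>0) (*-mono-≤ (i>0 (fromℕ t)) (i>0 (fromℕ t))))
  where
  i>0 : ∀ k → 0 < i k
  i>0 k = ≤-trans (n≤1+n 1) (i≥2 k)
  i≤last : ∀ k → i k ≤ i (fromℕ t)
  i≤last = ≤-last i (λ a b → <⇒≤ ∘ increasing a b)
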